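{- Let $x,y\in\mathbb N$ and let $e$ be a fusion. Put $\sigma:=\{y:=y^*_e\}$, $\tau:=\{x:=x^*_{e\setminus\{y\}}\}$, $\sigma':=\{x:=x^*_e\}$ and $\tau':=\{y:=y^*_{e\setminus\{x\}}\}$. Then: (1) if $[x]_e=[y]_e=\{x,y\}$, then $\tau\circ\sigma=\{y:=x\}$ and $\tau'\circ\sigma'=\{x:=y\}$; (2) if $x$ and $y$ are not $e$-equivalent, or $[x]_e=[y]_e$ strictly contains $\{x,y\}$, then $\tau\circ\sigma=\tau'\circ\sigma'$. In both cases $\tau\circ\sigma\sim\tau'\circ\sigma'$.
   Context: A fusion is an equivalence relation $e$ on $\mathbb N$ with all classes $[x]_e$ finite; $\Delta_{\mathbb N}$ is the identity relation; $e\setminus X:=(e\cap(\mathbb N\setminus X)^2)\cup\Delta_{\mathbb N}$. $x^*_e:=x$ if $[x]_e=\{x\}$ and $x^*_e:=\min([x]_e\setminus\{x\})$ otherwise. $\{x:=z\}$ denotes the function $\mathbb N\to\mathbb N$ sending $x$ to $z$ and fixing all other names; $(\alpha\circ\beta)(n)=\alpha(\beta(n))$. For $\alpha,\beta:\mathbb N\to\mathbb N$, $\alpha\sim\beta$ iff there is a finite permutation $\rho$ of $\mathbb N$ (a bijection moving only finitely many points) with $\alpha=\rho^{ -1}\circ\beta\circ\rho$. -}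

module Defs where

open import Data.Nat using (ℕ; _≟_; _≡ᵇ_; _⊓_; _≤_)
open import Data.Bool using (if_then_else_)
open import Data.List using (List; []; _∷_; filter; foldr)
open import Data.List.Membership.Propositional using (_∈_)
open import Data.List.Membership.Propositional.Properties using (∈-filter⁺; ∈-filter⁻)
open import Data.List.Relation.Unary.Any using (here; there)
open import Data.Product using (Σ; ∃; _×_; _,_; proj₁; proj₂)
open import Data.Sum using (_⊎_; inj₁; inj₂)
open import Data.Empty using (⊥-elim)
open import Function using (_∘_)
open import Function.Bundles using (_⇔_; mk⇔; Equivalence; _↔_; Inverse)
open import Relation.Nullary using (¬_; ¬?; yes; no)
open import Relation.Binary.Structures using (IsEquivalence)
open import Relation.Binary.PropositionalEquality using (_≡_; _≢_; refl; sym; trans; _≗_)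

-- Finiteness of [x] is witnessed (constructively) by an explicit list
-- `cls x` enumerating exactly the members of the class [x].

record Fusion : Set₁ where
  field
    _≈_           : ℕ → ℕ → Set
    isEquivalence : IsEquivalence _≈_
    cls           : ℕ → List ℕ
    cls-spec      : ∀ x y → (x ≈ y) ⇔ (y ∈ cls x)

open Fusion public

RelMinus : Fusion → ℕ → ℕ → ℕ → Set
RelMinus e y a b = (a ≡ b) ⊎ ((_≈_ e a b) × (a ≢ y) × (b ≢ y))

private
  module _ (e : Fusion) (y : ℕ) where
    R = RelMinus e y

    R-refl : ∀ {a} → R a a
    R-refl = inj₁ refl

    R-sym : ∀ {a b} → R a b → R b a
    R-sym (inj₁ p) = inj₁ (sym p)
    R-sym (inj₂ (p , q , r)) = inj₂ (IsEquivalence.sym (isEquivalence e) p , r , q)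

    R-trans : ∀ {a b c} → R a b → R b c → R a c
    R-trans (inj₁ refl) q = q
    R-trans (inj₂ p) (inj₁ refl) = inj₂ p
    R-trans (inj₂ (p , q , _)) (inj₂ (p' , _ , r')) =
      inj₂ (IsEquivalence.trans (isEquivalence e) p p' , q , r')

    clsM : ℕ → List ℕ
    clsM a with a ≟ y
    ... | yes _ = a ∷ []
    ... | no  _ = a ∷ filter (λ z → ¬? (z ≟ y)) (cls e a)

    toM : ∀ a b → R a b → b ∈ clsM a
    toM a b r with a ≟ y
    toM a b (inj₁ refl) | yes _ = here refl
    toM a b (inj₂ (_ , q , _)) | yes p = ⊥-elim (q p)
    toM a b (inj₁ refl) | no _ = here refl
    toM a b (inj₂ (p , _ , r)) | no _ =
      there (∈-filter⁺ (λ z → ¬? (z ≟ y)) (Equivalence.to (cls-spec e a b) p) r)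

    fromM : ∀ a b → b ∈ clsM a → R a b
    fromM a b m with a ≟ y
    fromM a b (here refl) | yes _ = inj₁ refl
    fromM a b (there ()) | yes _
    fromM a b (here refl) | no _ = inj₁ refl
    fromM a b (there m) | no q with ∈-filter⁻ (λ z → ¬? (z ≟ y)) m
    ... | m' , r = inj₂ (Equivalence.from (cls-spec e a b) m' , q , r)

_∖[_] : Fusion → ℕ → Fusion
e ∖[ y ] = record
  { _≈_           = RelMinus e y
  ; isEquivalence = record { refl = R-refl e y ; sym = R-sym e y ; trans = R-trans e y }
  ; cls           = clsM e y
  ; cls-spec      = λ a b → mk⇔ (toM e y a b) (fromM e y a b)
  }

minFrom : ℕ → List ℕ → ℕ
minFrom z zs = foldr _⊓_ z zs

star : Fusion → ℕ → ℕ
star e x with filter (λ z → ¬? (z ≟ x)) (cls e x)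
... | []     = x
... | z ∷ zs = minFrom z zs

upd : ℕ → ℕ → ℕ → ℕ
upd x z n = if n ≡ᵇ x then z else n

FinSupport : (ℕ → ℕ) → Set
FinSupport f = ∃ λ N → ∀ n → N ≤ n → f n ≡ n

_∼_ : (ℕ → ℕ) → (ℕ → ℕ) → Set
α ∼ β = Σ (ℕ ↔ ℕ) λ ρ →
          FinSupport (Inverse.to ρ) ×
          (α ≗ (Inverse.from ρ ∘ β ∘ Inverse.to ρ))

{-# OPTIONS --safe #-}
-- If [x]_e = [y]_e = {x, y}, then y*_e = x while x is isolated in e ∖ {y}, so τ ∘ σ collapses
-- to {y := x}; symmetrically τ' ∘ σ' = {x := y}, and the transposition (x y) conjugates one
-- into the other. If x and y are not equivalent, removing one name does not change the
-- partner of the other, and two updates with disjoint support and targets commute. If the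
-- class contains a third name, m := min ([x]_e ∖ {x, y}) is the partner of x in e ∖ {y} and of
-- y in e ∖ {x}, while x*_e ∈ {y, m} and y*_e ∈ {x, m}; both composites send x and y to m.
module Submission where

open import Defs
open import Data.Nat using (ℕ; _≟_; _≡ᵇ_; _⊓_; _≤_; _⊔_; suc; s≤s)
open import Data.Nat.Properties
  using (≡ᵇ⇒≡; ≡⇒≡ᵇ; ⊓-sel; m≤n⇒m⊓o≤n; m≤n⇒o⊓m≤n; ≤-refl; ≤-reflexive; ≤-antisym; ≤-trans;
         m≤m⊔n; m≤n⊔m; <⇒≢)
open import Data.Bool using (true; false)
open import Data.List using (List; []; _∷_; filter)
open import Data.List.Membership.Propositional using (_∈_)
open import Data.List.Membership.Propositional.Properties using (∈-filter⁺; ∈-filter⁻; foldr-selective)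
open import Data.List.Properties using (foldr-preservesᵒ)
open import Data.List.Relation.Unary.Any as Any using (here; there)
open import Data.Product using (∃; _×_; _,_; proj₁; proj₂)
open import Data.Sum using (_⊎_; inj₁; inj₂; [_,_]′; reduce; swap; map₂)
open import Data.Empty using (⊥-elim)
open import Function using (_∘_; id)
open import Function.Bundles using (_⇔_; Equivalence; mk↔ₛ′)
open import Function.Construct.Identity using (↔-id)
open import Relation.Nullary using (¬_; ¬?; yes; no)
open import Relation.Nullary.Decidable using (toSum)
open import Relation.Binary.Structures using (IsEquivalence)
open import Relation.Binary.PropositionalEquality
  using (_≡_; _≢_; _≗_; refl; sym; trans; subst; cong; ≢-sym; module ≡-Reasoning)

upd-same : ∀ x z → upd x z x ≡ z
upd-same x z with x ≡ᵇ x | ≡⇒≡ᵇ x x refl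
... | true  | _  = refl
... | false | ()

upd-other : ∀ {x z n} → n ≢ x → upd x z n ≡ n
upd-other {x} {z} {n} n≢x with n ≡ᵇ x | ≡ᵇ⇒≡ n x
... | true  | n≡x = ⊥-elim (n≢x (n≡x _))
... | false | _   = refl

upd-target : ∀ x z → upd x z z ≡ z
upd-target x z with z ≟ x
... | yes refl = upd-same x x
... | no  z≢x  = upd-other z≢x

upd-self : ∀ x → upd x x ≗ id
upd-self x n with n ≟ x
... | yes refl = upd-same n n
... | no  n≢x  = upd-other n≢x

upd-comm : ∀ {x y a b} → x ≢ y → a ≢ y → b ≢ x → upd x a ∘ upd y b ≗ upd y b ∘ upd x a
upd-comm {x} {y} {a} {b} x≢y a≢y b≢x n with n ≟ x | n ≟ y
... | yes refl | _ rewrite upd-other {z = b} x≢y | upd-same n a | upd-other {z = b} a≢y = refl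
... | no n≢x | yes refl rewrite upd-other {z = a} n≢x | upd-same n b | upd-other {z = a} b≢x = refl
... | no n≢x | no n≢y rewrite upd-other {z = a} n≢x | upd-other {z = b} n≢y | upd-other {z = a} n≢x = refl

upd-absorb : ∀ {x y a b} → b ≡ x ⊎ b ≡ a → upd x a ∘ upd y b ≗ upd x a ∘ upd y a
upd-absorb {x} {y} {a} {b} b∈xa n with n ≟ y
... | no n≢y rewrite upd-other {z = b} n≢y | upd-other {z = a} n≢y = refl
... | yes refl rewrite upd-same n b | upd-same n a | upd-target x a with b∈xa
...   | inj₁ refl = upd-same b a
...   | inj₂ refl = upd-target x b

minFrom-∈ : ∀ z zs → minFrom z zs ∈ z ∷ zs
minFrom-∈ z zs with foldr-selective ⊓-sel z zs
... | inj₁ min≡z  = here min≡z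
... | inj₂ min∈zs = there min∈zs

minFrom-≤ : ∀ {w} z zs → w ∈ z ∷ zs → minFrom z zs ≤ w
minFrom-≤ {w} z zs w∈ = foldr-preservesᵒ ⊓-pres z zs (lift w∈)
  where
  ⊓-pres : ∀ a b → a ≤ w ⊎ b ≤ w → a ⊓ b ≤ w
  ⊓-pres a b (inj₁ a≤w) = m≤n⇒m⊓o≤n b a≤w
  ⊓-pres a b (inj₂ b≤w) = m≤n⇒o⊓m≤n a b≤w
  lift : w ∈ z ∷ zs → z ≤ w ⊎ Any.Any (_≤ w) zs
  lift (here w≡z)   = inj₁ (≤-reflexive (sym w≡z))
  lift (there w∈zs) = inj₂ (Any.map (≤-reflexive ∘ sym) w∈zs)

_≈[_]_ : ℕ → Fusion → ℕ → Set
x ≈[ e ] z = _≈_ e x z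

Isolated : Fusion → ℕ → Set
Isolated e x = ∀ z → x ≈[ e ] z → z ≡ x

record LeastPartner (e : Fusion) (x m : ℕ) : Set where
  field
    related  : x ≈[ e ] m
    distinct : m ≢ x
    least    : ∀ z → x ≈[ e ] z → z ≢ x → m ≤ z

module _ (e : Fusion) where
  private
    module ≈ = IsEquivalence (isEquivalence e)

  partners : ℕ → List ℕ
  partners x = filter (λ z → ¬? (z ≟ x)) (cls e x)

  partners⁺ : ∀ {x z} → x ≈[ e ] z → z ≢ x → z ∈ partners x
  partners⁺ {x} {z} x≈z = ∈-filter⁺ (λ z → ¬? (z ≟ x)) (Equivalence.to (cls-spec e x z) x≈z)

  partners⁻ : ∀ {x z} → z ∈ partners x → x ≈[ e ] z × z ≢ x
  partners⁻ {x} {z} z∈ with ∈-filter⁻ (λ z → ¬? (z ≟ x)) {xs = cls e x} z∈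
  ... | z∈cls , z≢x = Equivalence.from (cls-spec e x z) z∈cls , z≢x

  star-spec : ∀ x → (Isolated e x × star e x ≡ x) ⊎ LeastPartner e x (star e x)
  star-spec x with partners x in eq
  ... | [] = inj₁ (isolated , refl)
    where
    isolated : Isolated e x
    isolated z x≈z with z ≟ x
    ... | yes z≡x = z≡x
    ... | no  z≢x with subst (z ∈_) eq (partners⁺ x≈z z≢x)
    ...   | ()
  ... | w ∷ ws = inj₂ record
    { related  = proj₁ min-partner
    ; distinct = proj₂ min-partner
    ; least    = λ z x≈z z≢x → minFrom-≤ w ws (subst (z ∈_) eq (partners⁺ x≈z z≢x))
    }
    where
    min-partner : x ≈[ e ] minFrom w ws × minFrom w ws ≢ x
    min-partner = partners⁻ (subst (minFrom w ws ∈_) (sym eq) (minFrom-∈ w ws))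

  star-isolated : ∀ {x} → Isolated e x → star e x ≡ x
  star-isolated {x} iso with star-spec x
  ... | inj₁ (_ , x*≡x) = x*≡x
  ... | inj₂ lp = ⊥-elim (LeastPartner.distinct lp (iso _ (LeastPartner.related lp)))

  star-leastPartner : ∀ {x m} → LeastPartner e x m → star e x ≡ m
  star-leastPartner {x} lp with star-spec x
  ... | inj₁ (iso , _) = ⊥-elim (distinct (iso _ related))
    where open LeastPartner lp
  ... | inj₂ lp* = ≤-antisym (least* _ related distinct) (least _ related* distinct*)
    where
    open LeastPartner lp
    open LeastPartner lp* renaming (related to related*; distinct to distinct*; least to least*)

  star-related : ∀ x → x ≈[ e ] star e x
  star-related x with star-spec x
  ... | inj₁ (_ , x*≡x) = subst (x ≈[ e ]_) (sym x*≡x) ≈.refl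
  ... | inj₂ lp = LeastPartner.related lp

  ¬isolated⇒leastPartner : ∀ {x} → ¬ Isolated e x → LeastPartner e x (star e x)
  ¬isolated⇒leastPartner {x} ¬iso with star-spec x
  ... | inj₁ (iso , _) = ⊥-elim (¬iso iso)
  ... | inj₂ lp = lp

  star-pair : ∀ {x y} → y ≈[ e ] x → (∀ z → y ≈[ e ] z → z ≡ x ⊎ z ≡ y) → star e y ≡ x
  star-pair {x} {y} y≈x class with x ≟ y
  ... | yes refl = star-isolated (λ z → reduce ∘ class z)
  ... | no x≢y = star-leastPartner record { related = y≈x ; distinct = x≢y ; least = least }
    where
    least : ∀ z → y ≈[ e ] z → z ≢ y → x ≤ z
    least z y≈z z≢y with class z y≈z
    ... | inj₁ refl = ≤-refl
    ... | inj₂ z≡y = ⊥-elim (z≢y z≡y)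

reroute : Fusion → ℕ → ℕ → ℕ → ℕ
reroute e x y = upd x (star (e ∖[ y ]) x) ∘ upd y (star e y)

module _ (e : Fusion) where
  private
    module ≈ = IsEquivalence (isEquivalence e)

  isolated-∖ : ∀ {x y} → (∀ z → x ≈[ e ] z → z ≡ x ⊎ z ≡ y) → Isolated (e ∖[ y ]) x
  isolated-∖ class z (inj₁ x≡z) = sym x≡z
  isolated-∖ class z (inj₂ (x≈z , _ , z≢y)) with class z x≈z
  ... | inj₁ z≡x = z≡x
  ... | inj₂ z≡y = ⊥-elim (z≢y z≡y)

  star-∖ : ∀ {x y} → x ≢ y → star e x ≢ y → star (e ∖[ y ]) x ≡ star e x
  star-∖ {x} {y} x≢y x*≢y with star-spec e x
  ... | inj₁ (iso , x*≡x) = trans (star-isolated (e ∖[ y ]) iso∖) (sym x*≡x)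
    where
    iso∖ : Isolated (e ∖[ y ]) x
    iso∖ z (inj₁ x≡z) = sym x≡z
    iso∖ z (inj₂ (x≈z , _)) = iso z x≈z
  ... | inj₂ lp = star-leastPartner (e ∖[ y ]) record
    { related  = inj₂ (related , x≢y , x*≢y)
    ; distinct = distinct
    ; least    = least∖
    }
    where
    open LeastPartner lp
    least∖ : ∀ z → x ≈[ e ∖[ y ] ] z → z ≢ x → star e x ≤ z
    least∖ z (inj₁ x≡z) z≢x = ⊥-elim (z≢x (sym x≡z))
    least∖ z (inj₂ (x≈z , _)) z≢x = least z x≈z z≢x

  star-∖-or : ∀ {x y} → x ≢ y → star e x ≡ y ⊎ star e x ≡ star (e ∖[ y ]) x
  star-∖-or {x} {y} x≢y with star e x ≟ y
  ... | yes x*≡y = inj₁ x*≡y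
  ... | no  x*≢y = inj₂ (sym (star-∖ x≢y x*≢y))

  leastPartner-∖-swap : ∀ {x y m} → x ≈[ e ] y →
                        LeastPartner (e ∖[ y ]) x m → LeastPartner (e ∖[ x ]) y m
  leastPartner-∖-swap {x} {y} {m} x≈y lp with LeastPartner.related lp
  ... | inj₁ x≡m = ⊥-elim (LeastPartner.distinct lp (sym x≡m))
  ... | inj₂ (x≈m , x≢y , m≢y) = record
    { related  = inj₂ (≈.trans (≈.sym x≈y) x≈m , ≢-sym x≢y , LeastPartner.distinct lp)
    ; distinct = m≢y
    ; least    = least
    }
    where
    least : ∀ z → y ≈[ e ∖[ x ] ] z → z ≢ y → m ≤ z
    least z (inj₁ y≡z) z≢y = ⊥-elim (z≢y (sym y≡z))
    least z (inj₂ (y≈z , _ , z≢x)) z≢y =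
      LeastPartner.least lp z (inj₂ (≈.trans x≈y y≈z , x≢y , z≢y)) z≢x

  pair-collapse : ∀ {x y} → (∀ z → x ≈[ e ] z → z ≡ x ⊎ z ≡ y) → y ≈[ e ] x →
                  (∀ z → y ≈[ e ] z → z ≡ x ⊎ z ≡ y) →
                  reroute e x y ≗ upd y x
  pair-collapse {x} {y} class-x y≈x class-y n
    rewrite star-isolated (e ∖[ y ]) (isolated-∖ class-x) | star-pair e y≈x class-y =
    upd-self x (upd y x n)

  ≉⇒≢ : ∀ {x y} → ¬ x ≈[ e ] y → x ≢ y
  ≉⇒≢ x≉y refl = x≉y ≈.refl

  star-≉ : ∀ {x y} → ¬ x ≈[ e ] y → star e x ≢ y
  star-≉ {x} x≉y x*≡y = x≉y (subst (x ≈[ e ]_) x*≡y (star-related e x))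

  reroute-comm-apart : ∀ {x y} → ¬ x ≈[ e ] y → reroute e x y ≗ reroute e y x
  reroute-comm-apart {x} {y} x≉y
    rewrite star-∖ (≉⇒≢ x≉y) (star-≉ x≉y) | star-∖ (≉⇒≢ (x≉y ∘ ≈.sym)) (star-≉ (x≉y ∘ ≈.sym)) =
    upd-comm (≉⇒≢ x≉y) (star-≉ x≉y) (star-≉ (x≉y ∘ ≈.sym))

  reroute-comm-shared : ∀ {x y} → x ≢ y → x ≈[ e ] y → ¬ Isolated (e ∖[ y ]) x →
                        reroute e x y ≗ reroute e y x
  reroute-comm-shared {x} {y} x≢y x≈y ¬iso n = begin
    upd x m (upd y (star e y) n) ≡⟨ upd-absorb (map₂ (λ p → trans p swapped) (star-∖-or (≢-sym x≢y))) n ⟩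
    upd x m (upd y m n)          ≡⟨ upd-comm x≢y m≢y m≢x n ⟩
    upd y m (upd x m n)          ≡⟨ upd-absorb (star-∖-or x≢y) n ⟨
    upd y m (upd x (star e x) n) ≡⟨ cong (λ k → upd y k (upd x (star e x) n)) swapped ⟨
    upd y (star (e ∖[ x ]) y) (upd x (star e x) n) ∎
    where
    open ≡-Reasoning
    m = star (e ∖[ y ]) x
    lp = ¬isolated⇒leastPartner (e ∖[ y ]) ¬iso
    swapped : star (e ∖[ x ]) y ≡ m
    swapped = star-leastPartner (e ∖[ x ]) (leastPartner-∖-swap x≈y lp)
    m≢x : m ≢ x
    m≢x = LeastPartner.distinct lp
    m≢y : m ≢ y
    m≢y = LeastPartner.distinct (leastPartner-∖-swap x≈y lp)

transpose : ℕ → ℕ → ℕ → ℕ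
transpose x y n with n ≟ x | n ≟ y
... | yes _ | _     = y
... | no _  | yes _ = x
... | no _  | no _  = n

transpose-left : ∀ x y → transpose x y x ≡ y
transpose-left x y with x ≟ x
... | yes _   = refl
... | no x≢x = ⊥-elim (x≢x refl)

transpose-right : ∀ x y → transpose x y y ≡ x
transpose-right x y with y ≟ x | y ≟ y
... | yes y≡x | _       = y≡x
... | no _    | yes _   = refl
... | no _    | no y≢y = ⊥-elim (y≢y refl)

transpose-other : ∀ {x y n} → n ≢ x → n ≢ y → transpose x y n ≡ n
transpose-other {x} {y} {n} n≢x n≢y with n ≟ x | n ≟ y
... | yes n≡x | _       = ⊥-elim (n≢x n≡x)
... | no _    | yes n≡y = ⊥-elim (n≢y n≡y)
... | no _    | no _    = refl

agree-on-pair : ∀ {f g : ℕ → ℕ} x y → f x ≡ g x → f y ≡ g y →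
                (∀ n → n ≢ x → n ≢ y → f n ≡ g n) → f ≗ g
agree-on-pair x y fx≡gx fy≡gy elsewhere n with n ≟ x | n ≟ y
... | yes refl | _        = fx≡gx
... | no _     | yes refl = fy≡gy
... | no n≢x   | no n≢y   = elsewhere n n≢x n≢y

transpose-involutive : ∀ x y → transpose x y ∘ transpose x y ≗ id
transpose-involutive x y = agree-on-pair x y
  (trans (cong (transpose x y) (transpose-left x y)) (transpose-right x y))
  (trans (cong (transpose x y) (transpose-right x y)) (transpose-left x y))
  (λ n n≢x n≢y → trans (cong (transpose x y) (transpose-other n≢x n≢y)) (transpose-other n≢x n≢y))

transpose-finSupport : ∀ x y → FinSupport (transpose x y)
transpose-finSupport x y = suc (x ⊔ y) , λ n x⊔y<n →
  transpose-other (≢-sym (<⇒≢ (≤-trans (s≤s (m≤m⊔n x y)) x⊔y<n)))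
                  (≢-sym (<⇒≢ (≤-trans (s≤s (m≤n⊔m x y)) x⊔y<n)))

upd-conj-transpose : ∀ x y → upd y x ≗ transpose x y ∘ upd x y ∘ transpose x y
upd-conj-transpose x y = agree-on-pair x y
  (begin
    upd y x x                       ≡⟨ upd-target y x ⟩
    x                               ≡⟨ transpose-right x y ⟨
    t y                             ≡⟨ cong t (upd-target x y) ⟨
    t (upd x y y)                   ≡⟨ cong (t ∘ upd x y) (transpose-left x y) ⟨
    t (upd x y (t x))               ∎)
  (begin
    upd y x y                       ≡⟨ upd-same y x ⟩
    x                               ≡⟨ transpose-right x y ⟨
    t y                             ≡⟨ cong t (upd-same x y) ⟨
    t (upd x y x)                   ≡⟨ cong (t ∘ upd x y) (transpose-right x y) ⟨
    t (upd x y (t y))               ∎)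
  (λ n n≢x n≢y → begin
    upd y x n                       ≡⟨ upd-other n≢y ⟩
    n                               ≡⟨ transpose-other n≢x n≢y ⟨
    t n                             ≡⟨ cong t (upd-other n≢x) ⟨
    t (upd x y n)                   ≡⟨ cong (t ∘ upd x y) (transpose-other n≢x n≢y) ⟨
    t (upd x y (t n))               ∎)
  where
  open ≡-Reasoning
  t = transpose x y

∼-transpose : ∀ {α β} x y → α ≗ transpose x y ∘ β ∘ transpose x y → α ∼ β
∼-transpose x y α≗ =
  mk↔ₛ′ (transpose x y) (transpose x y) (transpose-involutive x y) (transpose-involutive x y) ,
  transpose-finSupport x y , α≗

≗⇒∼ : ∀ {α β} → α ≗ β → α ∼ β
≗⇒∼ α≗β = ↔-id ℕ , (0 , λ _ _ → refl) , α≗β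

lemma2p8 : (x y : ℕ) (e : Fusion) →
    let σ  = upd y (star e y)
        τ  = upd x (star (e ∖[ y ]) x)
        σ' = upd x (star e x)
        τ' = upd y (star (e ∖[ x ]) y)
    in ((((z : ℕ) → _≈_ e x z ⇔ (z ≡ x ⊎ z ≡ y)) ×
         ((z : ℕ) → _≈_ e y z ⇔ (z ≡ x ⊎ z ≡ y))) →
          ((τ ∘ σ) ≗ upd y x) × ((τ' ∘ σ') ≗ upd x y))
     × ((¬ (_≈_ e x y) ⊎ (_≈_ e x y × ∃ λ z → _≈_ e x z × z ≢ x × z ≢ y)) →
          (τ ∘ σ) ≗ (τ' ∘ σ'))
     × (((((z : ℕ) → _≈_ e x z ⇔ (z ≡ x ⊎ z ≡ y)) ×
          ((z : ℕ) → _≈_ e y z ⇔ (z ≡ x ⊎ z ≡ y)))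
         ⊎ (¬ (_≈_ e x y) ⊎ (_≈_ e x y × ∃ λ z → _≈_ e x z × z ≢ x × z ≢ y))) →
          (τ ∘ σ) ∼ (τ' ∘ σ'))
lemma2p8 x y e = collapse , commute , conjugate
  where
  PairClass = ((z : ℕ) → x ≈[ e ] z ⇔ (z ≡ x ⊎ z ≡ y)) × ((z : ℕ) → y ≈[ e ] z ⇔ (z ≡ x ⊎ z ≡ y))
  ApartOrLarge = ¬ x ≈[ e ] y ⊎ (x ≈[ e ] y × ∃ λ z → x ≈[ e ] z × z ≢ x × z ≢ y)

  collapse : PairClass → reroute e x y ≗ upd y x × reroute e y x ≗ upd x y
  collapse (class-x , class-y) =
    pair-collapse e (λ z → Equivalence.to (class-x z)) (Equivalence.from (class-y x) (inj₁ refl))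
                    (λ z → Equivalence.to (class-y z)) ,
    pair-collapse e (λ z → swap ∘ Equivalence.to (class-y z)) (Equivalence.from (class-x y) (inj₂ refl))
                    (λ z → swap ∘ Equivalence.to (class-x z))

  commute : ApartOrLarge → reroute e x y ≗ reroute e y x
  commute (inj₁ x≉y) = reroute-comm-apart e x≉y
  commute (inj₂ (x≈y , z , x≈z , z≢x , z≢y)) = [ (λ { refl _ → refl }) , distinct ]′ (toSum (x ≟ y))
    where
    distinct : x ≢ y → reroute e x y ≗ reroute e y x
    distinct x≢y = reroute-comm-shared e x≢y x≈y (λ iso → z≢x (iso z (inj₂ (x≈z , x≢y , z≢y))))

  conjugate : PairClass ⊎ ApartOrLarge → reroute e x y ∼ reroute e y x
  conjugate (inj₂ h) = ≗⇒∼ (commute h)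
  conjugate (inj₁ pair) = ∼-transpose {β = reroute e y x} x y λ n → begin
    reroute e x y n                 ≡⟨ proj₁ (collapse pair) n ⟩
    upd y x n                       ≡⟨ upd-conj-transpose x y n ⟩
    t (upd x y (t n))               ≡⟨ cong t (proj₂ (collapse pair) (t n)) ⟨
    t (reroute e y x (t n))         ∎
    where
    open ≡-Reasoning
    t = transpose x y
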